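{- Let $\mathbb K$ be a field, $X$ a finite set and $G$ a permutation groupoid on $X$. Then the invariant ring $\mathbb K[X]^G$ is a subring of $\mathbb K[X]$, i.e. it is closed under multiplication.
   Context: A local bijection of $X$ is a bijection $f:\operatorname{dom}f\to\operatorname{im}f$ between subsets of $X$. A permutation groupoid on $X$ is a set $G$ of local bijections containing the identity of $X$ and closed under restriction to subsets of the domain, inverses, and composition $f\circ g$ whenever $\operatorname{im}g=\operatorname{dom}f$. For $f\in G$ and a monomial $x^d=\prod_{i\in X}x_i^{d_i}$ whose support $\{i:d_i>0\}$ is contained in $\operatorname{dom}f$, set $f.x^d=\prod_{d_i>0}x_{f(i)}^{d_i}$. The $G$-orbit of $x^d$ is the set of all such monomials $f.x^d$ ($f\in G$), and the orbit sum $o(x^d)$ is the sum of the monomials in this orbit. The invariant ring $\mathbb K[X]^G$ is the linear subspace of $\mathbb K[X]$ spanned by all orbit sums. -}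

module Defs where

open import Level using (Level; _⊔_; suc)
open import Algebra.Bundles using (CommutativeRing)
open import Data.Nat as ℕ using (ℕ; zero; _∸_)
open import Data.Fin using (Fin)
import Data.Fin as F
open import Data.Bool using (Bool; true; false)
open import Data.List using (List; []; _∷_; upTo; concatMap; map; foldr)
open import Data.List.Relation.Unary.Any using (Any)
open import Data.Product using (Σ; _×_; ∃; ∃-syntax; _,_)
open import Relation.Nullary using (¬_)
open import Relation.Binary.PropositionalEquality using (_≡_; _≢_)

record Field (c ℓ : Level) : Set (suc (c ⊔ ℓ)) where
  field
    commRing : CommutativeRing c ℓ
  open CommutativeRing commRing public
  field
    1≉0     : ¬ (1# ≈ 0#)
    inverse : ∀ x → ¬ (x ≈ 0#) → ∃[ y ] (x * y ≈ 1#)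

-- The finite set X is Fin n.  Subsets of X are Bool-valued predicates.

Subset : ℕ → Set
Subset n = Fin n → Bool

_∈ₛ_ : ∀ {n} → Fin n → Subset n → Set
i ∈ₛ S = S i ≡ true

-- A local bijection of X: a domain, and a map that is injective on the
-- domain (values outside the domain are irrelevant).  Its image is
-- { fun i | i ∈ dom }, and fun is a bijection dom → im.
record LocalBij (n : ℕ) : Set where
  field
    dom : Subset n
    fun : Fin n → Fin n
    inj : ∀ i j → i ∈ₛ dom → j ∈ₛ dom → fun i ≡ fun j → i ≡ j
open LocalBij public

InIm : ∀ {n} → LocalBij n → Fin n → Set
InIm f j = ∃[ i ] (i ∈ₛ dom f × fun f i ≡ j)

_≈ᴸ_ : ∀ {n} → LocalBij n → LocalBij n → Set
f ≈ᴸ g = (∀ i → dom f i ≡ dom g i) × (∀ i → i ∈ₛ dom f → fun f i ≡ fun g i)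

_∈ᴳ_ : ∀ {n} → LocalBij n → List (LocalBij n) → Set
f ∈ᴳ G = Any (λ g → g ≈ᴸ f) G

record IsPermGroupoid {n : ℕ} (G : List (LocalBij n)) : Set where
  field
    hasId    : ∃[ g ] (g ∈ᴳ G × (∀ i → i ∈ₛ dom g) × (∀ i → fun g i ≡ i))
    restrict : ∀ f → f ∈ᴳ G → (S : Subset n) → (∀ i → i ∈ₛ S → i ∈ₛ dom f) →
               ∃[ g ] (g ∈ᴳ G × (∀ i → dom g i ≡ S i)
                               × (∀ i → i ∈ₛ S → fun g i ≡ fun f i))
    inverse  : ∀ f → f ∈ᴳ G →
               ∃[ g ] (g ∈ᴳ G × (∀ j → (j ∈ₛ dom g → InIm f j) × (InIm f j → j ∈ₛ dom g))
                               × (∀ i → i ∈ₛ dom f → fun g (fun f i) ≡ i))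
    compose  : ∀ f g → f ∈ᴳ G → g ∈ᴳ G →
               (∀ j → (InIm g j → j ∈ₛ dom f) × (j ∈ₛ dom f → InIm g j)) →
               ∃[ h ] (h ∈ᴳ G × (∀ i → dom h i ≡ dom g i)
                               × (∀ i → i ∈ₛ dom g → fun h i ≡ fun f (fun g i)))

-- Monomials x^d are exponent vectors d : Fin n → ℕ.

Mono : ℕ → Set
Mono n = Fin n → ℕ

-- Acts f d e  :  supp d ⊆ dom f  and  e = f.x^d, i.e.
-- e (f i) = d i for i ∈ dom f, and e j = 0 for j outside im f.
Acts : ∀ {n} → LocalBij n → Mono n → Mono n → Set
Acts f d e = (∀ i → d i ≢ 0 → i ∈ₛ dom f)
           × (∀ i → i ∈ₛ dom f → e (fun f i) ≡ d i)
           × (∀ j → ¬ InIm f j → e j ≡ 0)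

InOrbit : ∀ {n} → List (LocalBij n) → Mono n → Mono n → Set
InOrbit G d e = ∃[ f ] (f ∈ᴳ G × Acts f d e)

-- Polynomials over a field K in variables X = Fin n, as coefficient
-- functions (monomial ↦ coefficient); equality is pointwise.

module Poly {c ℓ} (K : Field c ℓ) (n : ℕ) where
  open Field K

  Pol : Set c
  Pol = Mono n → Carrier

  _≈ₚ_ : Pol → Pol → Set ℓ
  p ≈ₚ q = ∀ e → p e ≈ q e

  below : ∀ {m} → Mono m → List (Mono m)
  below {zero}    d = (λ ()) ∷ []
  below {ℕ.suc m} d =
    concatMap (λ k → map (λ a → λ { F.zero → k ; (F.suc i) → a i })
                         (below (λ i → d (F.suc i))))
              (upTo (ℕ.suc (d F.zero)))

  Σ[_]_ : ∀ {A : Set} → List A → (A → Carrier) → Carrier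
  Σ[ xs ] f = foldr (λ x acc → f x + acc) 0# xs

  _·ₚ_ : Pol → Pol → Pol
  (p ·ₚ q) d = Σ[ below d ] (λ a → p a * q (λ i → d i ∸ a i))

  IsOrbitSum : List (LocalBij n) → Mono n → Pol → Set ℓ
  IsOrbitSum G d q = ∀ e → (InOrbit G d e → q e ≈ 1#) × (¬ InOrbit G d e → q e ≈ 0#)

  record Term (G : List (LocalBij n)) : Set (c ⊔ ℓ) where
    field
      coeff : Carrier
      mono  : Mono n
      osum  : Pol
      isOS  : IsOrbitSum G mono osum

  evalTerms : ∀ {G} → List (Term G) → Pol
  evalTerms []       e = 0#
  evalTerms (t ∷ ts) e = Term.coeff t * Term.osum t e + evalTerms ts e

  -- the invariant ring K[X]^G: the K-span of all orbit sums
  InInvariantRing : List (LocalBij n) → Pol → Set (c ⊔ ℓ)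
  InInvariantRing G p = ∃[ ts ] (p ≈ₚ evalTerms {G} ts)

module Submission where

-- Because G is a groupoid, lying in a common G-orbit is an equivalence relation on
-- monomials, and a polynomial whose coefficients are constant on orbits and vanish
-- outside finitely many monomials lies in K[X]^G (subtract coefficient · orbit sum,
-- one orbit at a time).  By bilinearity it suffices to multiply two orbit sums
-- o(x^a) o(x^b): the coefficient of x^d counts the divisors x^c of x^d with x^c in
-- the orbit of x^a and x^(d-c) in the orbit of x^b.  An f ∈ G carrying x^d to x^e
-- transports such divisors injectively to those of x^e, and so does f⁻¹ backwards,
-- so the count is constant on orbits; it is 0 once an exponent of d exceeds
-- deg a + deg b.

open import Defs
open import Data.Nat as ℕ using (ℕ; zero; suc; _≤_; _∸_; z≤n; s≤s)
import Data.Nat.Properties as ℕₚ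
open import Data.Fin as Fin using (Fin)
import Data.Fin.Properties as Finₚ
open import Data.Bool as Bool using (Bool; true; false)
open import Data.List as List using (List; []; _∷_; _++_; length; filter; lookup; concatMap; upTo)
open import Data.List.Relation.Unary.Any as Any using (Any; here; there)
import Data.List.Relation.Unary.Any.Properties as Anyₚ
open import Data.List.Relation.Unary.All as All using (All; []; _∷_)
import Data.List.Relation.Unary.All.Properties as Allₚ
open import Data.List.Relation.Unary.AllPairs as AllPairs using (AllPairs; []; _∷_)
import Data.List.Relation.Unary.AllPairs.Properties as AllPairsₚ
open import Data.List.Relation.Unary.Unique.Setoid using (Unique)
import Data.List.Relation.Unary.Unique.Propositional.Properties as Uniqueₚ
open import Data.List.Membership.Propositional using (_∈_)
open import Data.List.Membership.Propositional.Properties using (∈-lookup; ∈-filter⁻; ∈-upTo⁺; ∈-upTo⁻)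
import Data.List.Properties as Listₚ
open import Data.Vec.Functional using (head; tail)
open import Data.Product using (_×_; ∃-syntax; _,_; proj₁; proj₂)
open import Data.Empty using (⊥-elim)
open import Level using (0ℓ)
open import Relation.Binary.Bundles using (Setoid)
open import Relation.Nullary using (¬_; Dec; yes; no)
open import Relation.Nullary.Decidable using (_×-dec_; _→-dec_; ¬?; map′)
open import Relation.Binary.PropositionalEquality as ≡ using (_≡_; _≢_; refl; cong; cong₂; subst; _≗_)

isNonZero : ℕ → Bool
isNonZero zero    = false
isNonZero (suc _) = true

isNonZero⇒≢0 : ∀ {k} → isNonZero k ≡ true → k ≢ 0
isNonZero⇒≢0 {suc k} _ ()

≢0⇒isNonZero : ∀ {k} → k ≢ 0 → isNonZero k ≡ true
≢0⇒isNonZero {zero}  k≢0 = ⊥-elim (k≢0 refl)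
≢0⇒isNonZero {suc k} _   = refl

support : ∀ {n} → Mono n → Subset n
support d i = isNonZero (d i)

_≤ᵐ_ : ∀ {m} → Mono m → Mono m → Set
c ≤ᵐ d = ∀ i → c i ≤ d i

_∸ᵐ_ : ∀ {m} → Mono m → Mono m → Mono m
(d ∸ᵐ c) i = d i ∸ c i

≤ᵐ-zero : ∀ {m} {c d : Mono m} {i} → c ≤ᵐ d → d i ≡ 0 → c i ≡ 0
≤ᵐ-zero {c = c} {i = i} c≤d di≡0 = ℕₚ.n≤0⇒n≡0 (subst (c i ≤_) di≡0 (c≤d i))

Monoₛ : ℕ → Setoid 0ℓ 0ℓ
Monoₛ m = Fin m ≡.→-setoid ℕ

_∈ᵐ_ : ∀ {m} → Mono m → List (Mono m) → Set
c ∈ᵐ ds = Any (c ≗_) ds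

degree : ∀ {m} → Mono m → ℕ
degree {zero}  d = 0
degree {suc m} d = head d ℕ.+ degree (tail d)

≤-degree : ∀ {m} (d : Mono m) i → d i ≤ degree d
≤-degree d Fin.zero    = ℕₚ.m≤m+n _ _
≤-degree d (Fin.suc i) = ℕₚ.≤-trans (≤-degree (tail d) i) (ℕₚ.m≤n+m _ _)

module _ {a ℓ} (S : Setoid a ℓ) where
  open Setoid S using (_≈_; reflexive; sym; trans)
  open import Data.List.Membership.Setoid S using () renaming (_∈_ to _∈≈_)

  lookup-injective : ∀ {xs} → Unique S xs → ∀ k l → lookup xs k ≈ lookup xs l → k ≡ l
  lookup-injective (_ ∷ _)        Fin.zero    Fin.zero    _     = refl
  lookup-injective (x≉xs ∷ _)     Fin.zero    (Fin.suc l) x≈xₗ  = ⊥-elim (All.lookup x≉xs (∈-lookup l) x≈xₗ)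
  lookup-injective (x≉xs ∷ _)     (Fin.suc k) Fin.zero    xₖ≈x  = ⊥-elim (All.lookup x≉xs (∈-lookup k) (sym xₖ≈x))
  lookup-injective (_ ∷ distinct) (Fin.suc k) (Fin.suc l) xₖ≈xₗ = cong Fin.suc (lookup-injective distinct k l xₖ≈xₗ)

  length-≤-injection : ∀ {xs ys} (φ : Setoid.Carrier S → Setoid.Carrier S) → Unique S xs →
    (∀ {x} → x ∈ xs → φ x ∈≈ ys) → (∀ {x x′} → x ∈ xs → x′ ∈ xs → φ x ≈ φ x′ → x ≈ x′) →
    length xs ≤ length ys
  length-≤-injection {xs} {ys} φ distinct into φ-injective = Finₚ.injective⇒≤ index-injective
    where
    index : Fin (length xs) → Fin (length ys)
    index k = Any.index (into (∈-lookup k))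
    index-injective : ∀ {k l} → index k ≡ index l → k ≡ l
    index-injective {k} {l} eq = lookup-injective distinct k l (φ-injective (∈-lookup k) (∈-lookup l)
      (trans (Anyₚ.lookup-index (into (∈-lookup k)))
      (trans (reflexive (cong (lookup ys) eq)) (sym (Anyₚ.lookup-index (into (∈-lookup l)))))))

module _ {n : ℕ} where
  InIm? : ∀ (f : LocalBij n) j → Dec (InIm f j)
  InIm? f j = Finₚ.any? (λ i → (dom f i Bool.≟ true) ×-dec (fun f i Finₚ.≟ j))

  Acts? : ∀ (f : LocalBij n) d e → Dec (Acts f d e)
  Acts? f d e =
    Finₚ.all? (λ i → ¬? (d i ℕ.≟ 0) →-dec (dom f i Bool.≟ true)) ×-dec
    (Finₚ.all? (λ i → (dom f i Bool.≟ true) →-dec (e (fun f i) ℕ.≟ d i)) ×-dec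
     Finₚ.all? (λ j → ¬? (InIm? f j) →-dec (e j ℕ.≟ 0)))

  Acts-resp-≈ᴸ : ∀ {f g : LocalBij n} {d e} → g ≈ᴸ f → Acts f d e → Acts g d e
  Acts-resp-≈ᴸ {e = e} (dom≡ , fun≡) (supp⊆dom , onDom , offIm) =
    (λ i di≢0 → ≡.trans (dom≡ i) (supp⊆dom i di≢0)) ,
    (λ i i∈g → ≡.trans (cong e (fun≡ i i∈g)) (onDom i (≡.trans (≡.sym (dom≡ i)) i∈g))) ,
    (λ j j∉im → offIm j λ { (i , i∈f , fi≡j) →
      j∉im (i , ≡.trans (dom≡ i) i∈f , ≡.trans (fun≡ i (≡.trans (dom≡ i) i∈f)) fi≡j) })

  Acts-resp-≗ : ∀ {f : LocalBij n} {d d′ e e′} → d ≗ d′ → e ≗ e′ → Acts f d e → Acts f d′ e′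
  Acts-resp-≗ {f = f} {e = e} {e′} d≗d′ e≗e′ (supp⊆dom , onDom , offIm) =
    (λ i d′i≢0 → supp⊆dom i (λ di≡0 → d′i≢0 (≡.trans (≡.sym (d≗d′ i)) di≡0))) ,
    (λ i i∈f → ≡.trans (≡.sym (e≗e′ (fun f i))) (≡.trans (onDom i i∈f) (d≗d′ i))) ,
    (λ j j∉im → ≡.trans (≡.sym (e≗e′ j)) (offIm j j∉im))

  Acts⇒InIm : ∀ {f : LocalBij n} {d e j} → Acts f d e → e j ≢ 0 → InIm f j
  Acts⇒InIm {f = f} {j = j} (_ , _ , offIm) ej≢0 with InIm? f j
  ... | yes j∈im = j∈im
  ... | no  j∉im = ⊥-elim (ej≢0 (offIm j j∉im))

  module Transport (f : LocalBij n) {x y : Mono n} (act : Acts f x y) where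
    private
      supp⊆dom : ∀ i → x i ≢ 0 → i ∈ₛ dom f
      supp⊆dom = proj₁ act
      onDom : ∀ i → i ∈ₛ dom f → y (fun f i) ≡ x i
      onDom = proj₁ (proj₂ act)
      offIm : ∀ j → ¬ InIm f j → y j ≡ 0
      offIm = proj₂ (proj₂ act)

    transport : Mono n → Mono n
    transport c j with InIm? f j
    ... | yes (i , _) = c i
    ... | no  _       = 0

    transport-onDom : ∀ c {i} → i ∈ₛ dom f → transport c (fun f i) ≡ c i
    transport-onDom c {i} i∈f with InIm? f (fun f i)
    ... | yes (i′ , i′∈f , fi′≡fi) = cong c (inj f i′ i i′∈f i∈f fi′≡fi)
    ... | no  fi∉im                = ⊥-elim (fi∉im (i , i∈f , refl))

    transport-offIm : ∀ c {j} → ¬ InIm f j → transport c j ≡ 0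
    transport-offIm c {j} j∉im with InIm? f j
    ... | yes j∈im = ⊥-elim (j∉im j∈im)
    ... | no  _    = refl

    transport-≤ᵐ : ∀ {c} → c ≤ᵐ x → transport c ≤ᵐ y
    transport-≤ᵐ {c} c≤x j with InIm? f j
    ... | yes (i , i∈f , refl) = subst (c i ≤_) (≡.sym (onDom i i∈f)) (c≤x i)
    ... | no  _                = z≤n

    transport-acts : ∀ {c} → c ≤ᵐ x → Acts f c (transport c)
    transport-acts {c} c≤x =
      (λ i ci≢0 → supp⊆dom i (λ xi≡0 → ci≢0 (≤ᵐ-zero c≤x xi≡0))) ,
      (λ i i∈f → transport-onDom c i∈f) ,
      (λ j j∉im → transport-offIm c j∉im)

    transport-acts-∸ᵐ : ∀ c → Acts f (x ∸ᵐ c) (y ∸ᵐ transport c)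
    transport-acts-∸ᵐ c =
      (λ i xi∸ci≢0 → supp⊆dom i (λ xi≡0 → xi∸ci≢0 (≡.trans (cong (_∸ c i) xi≡0) (ℕₚ.0∸n≡0 (c i))))) ,
      (λ i i∈f → cong₂ _∸_ (onDom i i∈f) (transport-onDom c i∈f)) ,
      (λ j j∉im → ≡.trans (cong (_∸ transport c j) (offIm j j∉im)) (ℕₚ.0∸n≡0 (transport c j)))

    transport-injective : ∀ {c c′} → c ≤ᵐ x → c′ ≤ᵐ x → transport c ≗ transport c′ → c ≗ c′
    transport-injective {c} {c′} c≤x c′≤x eq i with dom f i in i∈?
    ... | true  = ≡.trans (≡.sym (transport-onDom c i∈?)) (≡.trans (eq (fun f i)) (transport-onDom c′ i∈?))
    ... | false with x i ℕ.≟ 0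
    ...   | yes xi≡0 = ≡.trans (≤ᵐ-zero c≤x xi≡0) (≡.sym (≤ᵐ-zero c′≤x xi≡0))
    ...   | no  xi≢0 with () ← ≡.trans (≡.sym i∈?) (supp⊆dom i xi≢0)

module Orbits {n : ℕ} (G : List (LocalBij n)) (isPermGroupoid : IsPermGroupoid G) where
  open IsPermGroupoid isPermGroupoid

  _~_ : Mono n → Mono n → Set
  d ~ e = InOrbit G d e

  InOrbit? : ∀ d e → Dec (d ~ e)
  InOrbit? d e = map′ (fromAny G) toAny (Any.any? (λ g → Acts? g d e) G)
    where
    fromAny : ∀ H → Any (λ g → Acts g d e) H → ∃[ f ] (f ∈ᴳ H × Acts f d e)
    fromAny (g ∷ H) (here act) = g , here ((λ _ → refl) , (λ _ _ → refl)) , act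
    fromAny (g ∷ H) (there p) with fromAny H p
    ... | f , f∈H , act = f , there f∈H , act
    toAny : d ~ e → Any (λ g → Acts g d e) G
    toAny (f , f∈G , act) = Any.map (λ {g} g≈f → Acts-resp-≈ᴸ {f = f} {g = g} g≈f act) f∈G

  InOrbit-resp-≗ : ∀ {d d′ e e′} → d ≗ d′ → e ≗ e′ → d ~ e → d′ ~ e′
  InOrbit-resp-≗ d≗d′ e≗e′ (f , f∈G , act) = f , f∈G , Acts-resp-≗ {f = f} d≗d′ e≗e′ act

  InOrbit-refl : ∀ d → d ~ d
  InOrbit-refl d with hasId
  ... | g , g∈G , total , isId =
    g , g∈G , (λ i _ → total i) , (λ i _ → cong d (isId i)) ,
    (λ j j∉im → ⊥-elim (j∉im (j , total j , isId j)))

  -- Restricting the witness to supp d makes its image exactly supp e, as composition requires.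
  InOrbit⇒restricted : ∀ {d e} → d ~ e →
    ∃[ g ] (g ∈ᴳ G × Acts g d e × (∀ i → dom g i ≡ support d i))
  InOrbit⇒restricted {d} {e} (f , f∈G , act@(supp⊆dom , onDom , _))
    with restrict f f∈G (support d) (λ i i∈supp → supp⊆dom i (isNonZero⇒≢0 i∈supp))
  ... | g , g∈G , domg , fung = g , g∈G , (supp⊆domg , onDomg , offImg) , domg
    where
    supp⊆domg : ∀ i → d i ≢ 0 → i ∈ₛ dom g
    supp⊆domg i di≢0 = ≡.trans (domg i) (≢0⇒isNonZero di≢0)
    onDomg : ∀ i → i ∈ₛ dom g → e (fun g i) ≡ d i
    onDomg i i∈g = ≡.trans (cong e (fung i i∈supp)) (onDom i (supp⊆dom i (isNonZero⇒≢0 i∈supp)))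
      where
      i∈supp : i ∈ₛ support d
      i∈supp = ≡.trans (≡.sym (domg i)) i∈g
    imf⇒img : ∀ {j} → e j ≢ 0 → InIm f j → InIm g j
    imf⇒img ej≢0 (i , i∈f , refl) =
      i , supp⊆domg i di≢0 , ≡.trans (fung i (≢0⇒isNonZero di≢0)) refl
      where
      di≢0 : d i ≢ 0
      di≢0 di≡0 = ej≢0 (≡.trans (onDom i i∈f) di≡0)
    offImg : ∀ j → ¬ InIm g j → e j ≡ 0
    offImg j j∉img with e j ℕ.≟ 0
    ... | yes ej≡0 = ej≡0
    ... | no  ej≢0 = ⊥-elim (j∉img (imf⇒img ej≢0 (Acts⇒InIm {f = f} act ej≢0)))

  InOrbit-sym : ∀ {d e} → d ~ e → e ~ d
  InOrbit-sym {d} {e} (f , f∈G , act@(supp⊆dom , onDom , _)) with inverse f f∈G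
  ... | g , g∈G , domg⇔imf , left-inverse = g , g∈G , (supp⊆domg , onDomg , offImg)
    where
    supp⊆domg : ∀ j → e j ≢ 0 → j ∈ₛ dom g
    supp⊆domg j ej≢0 = proj₂ (domg⇔imf j) (Acts⇒InIm {f = f} act ej≢0)
    onDomg : ∀ j → j ∈ₛ dom g → d (fun g j) ≡ e j
    onDomg j j∈g with proj₁ (domg⇔imf j) j∈g
    ... | i , i∈f , refl = ≡.trans (cong d (left-inverse i i∈f)) (≡.sym (onDom i i∈f))
    offImg : ∀ i → ¬ InIm g i → d i ≡ 0
    offImg i i∉img with d i ℕ.≟ 0
    ... | yes di≡0 = di≡0
    ... | no  di≢0 = ⊥-elim (i∉img
      (fun f i , proj₂ (domg⇔imf (fun f i)) (i , supp⊆dom i di≢0 , refl) ,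
       left-inverse i (supp⊆dom i di≢0)))

  composable : ∀ {f h : LocalBij n} {d e} → Acts f d e →
    (∀ i → dom f i ≡ support d i) → (∀ j → dom h j ≡ support e j) →
    ∀ j → (InIm f j → j ∈ₛ dom h) × (j ∈ₛ dom h → InIm f j)
  composable {f} {h} actf@(_ , onDomf , _) domf domh j = imf⊆domh , domh⊆imf
    where
    imf⊆domh : InIm f j → j ∈ₛ dom h
    imf⊆domh (i , i∈f , refl) = ≡.trans (domh (fun f i)) (≢0⇒isNonZero λ efi≡0 →
      isNonZero⇒≢0 (≡.trans (≡.sym (domf i)) i∈f) (≡.trans (≡.sym (onDomf i i∈f)) efi≡0))
    domh⊆imf : j ∈ₛ dom h → InIm f j
    domh⊆imf j∈h = Acts⇒InIm {f = f} actf (isNonZero⇒≢0 (≡.trans (≡.sym (domh j)) j∈h))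

  InOrbit-trans : ∀ {d e e′} → d ~ e → e ~ e′ → d ~ e′
  InOrbit-trans {d} {e′ = e′} d~e e~e′
    with InOrbit⇒restricted d~e | InOrbit⇒restricted e~e′
  ... | f , f∈G , actf@(supp⊆domf , onDomf , _) , domf
      | h , h∈G , acth@(_ , onDomh , _) , domh
    with compose h f h∈G f∈G (composable {f} {h} actf domf domh)
  ... | k , k∈G , domk , funk = k , k∈G , (supp⊆domk , onDomk , offImk)
    where
    supp⊆domk : ∀ i → d i ≢ 0 → i ∈ₛ dom k
    supp⊆domk i di≢0 = ≡.trans (domk i) (supp⊆domf i di≢0)
    onDomk : ∀ i → i ∈ₛ dom k → e′ (fun k i) ≡ d i
    onDomk i i∈k = ≡.trans (cong e′ (funk i i∈f))
      (≡.trans (onDomh (fun f i) (proj₁ (composable {f} {h} actf domf domh _) (i , i∈f , refl)))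
             (onDomf i i∈f))
      where
      i∈f : i ∈ₛ dom f
      i∈f = ≡.trans (≡.sym (domk i)) i∈k
    imh⊆imk : ∀ {j} → InIm h j → InIm k j
    imh⊆imk (m , m∈h , refl) with proj₂ (composable {f} {h} actf domf domh m) m∈h
    ... | i , i∈f , refl = i , ≡.trans (domk i) i∈f , funk i i∈f
    offImk : ∀ j → ¬ InIm k j → e′ j ≡ 0
    offImk j j∉imk with e′ j ℕ.≟ 0
    ... | yes e′j≡0 = e′j≡0
    ... | no  e′j≢0 = ⊥-elim (j∉imk (imh⊆imk (Acts⇒InIm {f = h} acth e′j≢0)))

  InOrbit⇒≤degree : ∀ {d e} → d ~ e → ∀ j → e j ≤ degree d
  InOrbit⇒≤degree {d} {e} (f , _ , (_ , onDom , offIm)) j with InIm? f j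
  ... | yes (i , i∈f , refl) = subst (_≤ degree d) (≡.sym (onDom i i∈f)) (≤-degree d i)
  ... | no  j∉im             = subst (_≤ degree d) (≡.sym (offIm j j∉im)) z≤n

module Divisors {c ℓ} (K : Field c ℓ) (n : ℕ) where
  open Poly K n using (below)

  private
    IsCons : ∀ {m} → (ℕ → Mono m → Mono (suc m)) → Set
    IsCons g = ∀ k a → g k a Fin.zero ≡ k × (∀ i → g k a (Fin.suc i) ≡ a i)

    -- below builds its elements with an anonymous pattern lambda, which cannot be named here.
    Below : ∀ {m} → (ℕ → Mono m → Mono (suc m)) → Mono (suc m) → List (Mono (suc m))
    Below g d = concatMap (λ k → List.map (g k) (below (tail d))) (upTo (suc (head d)))

  below-sound : ∀ {m} (d : Mono m) → All (_≤ᵐ d) (below d)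
  below-sound {zero}  d = (λ ()) ∷ []
  below-sound {suc m} d = go _ (λ _ _ → refl , λ _ → refl)
    where
    go : ∀ g → IsCons g → All (_≤ᵐ d) (Below g d)
    go g isCons = Allₚ.concat⁺ (Allₚ.map⁺ (All.tabulate λ {k} k∈ → Allₚ.map⁺
      (All.map (λ {a} a≤tail → λ
        { Fin.zero    → subst (_≤ head d) (≡.sym (proj₁ (isCons k a))) (ℕₚ.≤-pred (∈-upTo⁻ k∈))
        ; (Fin.suc i) → subst (_≤ d (Fin.suc i)) (≡.sym (proj₂ (isCons k a) i)) (a≤tail i) })
        (below-sound (tail d)))))

  below-complete : ∀ {m} (d c : Mono m) → c ≤ᵐ d → c ∈ᵐ below d
  below-complete {zero}  d c c≤d = here (λ ())
  below-complete {suc m} d c c≤d = go _ (λ _ _ → refl , λ _ → refl)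
    where
    go : ∀ g → IsCons g → c ∈ᵐ Below g d
    go g isCons = Anyₚ.concat⁺ (Anyₚ.map⁺ (Any.map (λ { refl → Anyₚ.map⁺ (Any.map (λ {a} tail≗a → λ
        { Fin.zero    → ≡.sym (proj₁ (isCons _ a))
        ; (Fin.suc i) → ≡.trans (tail≗a i) (≡.sym (proj₂ (isCons _ a) i)) })
        (below-complete (tail d) (tail c) (λ i → c≤d (Fin.suc i)))) })
      (∈-upTo⁺ (s≤s (c≤d Fin.zero)))))

  below-unique : ∀ {m} (d : Mono m) → Unique (Monoₛ m) (below d)
  below-unique {zero}  d = [] ∷ []
  below-unique {suc m} d =
    go _ (λ _ _ → refl , λ _ → refl) (upTo (suc (head d))) (Uniqueₚ.upTo⁺ (suc (head d)))
    where
    go : ∀ g → IsCons g → ∀ ks → AllPairs _≢_ ks →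
         Unique (Monoₛ (suc m)) (concatMap (λ k → List.map (g k) (below (tail d))) ks)
    go g isCons ks distinct = AllPairsₚ.concat⁺
      (Allₚ.map⁺ (All.tabulate λ {k} _ → AllPairsₚ.map⁺ (AllPairs.map (λ {a} {a′} a≢a′ ga≗ga′ →
        a≢a′ (λ i → ≡.trans (≡.sym (proj₂ (isCons k a) i)) (≡.trans (ga≗ga′ (Fin.suc i)) (proj₂ (isCons k a′) i))))
        (below-unique (tail d)))))
      (AllPairsₚ.map⁺ (AllPairs.map (λ {k} {k′} k≢k′ → Allₚ.map⁺ (All.tabulate λ {a} _ →
        Allₚ.map⁺ (All.tabulate λ {a′} _ ga≗ga′ →
          k≢k′ (≡.trans (≡.sym (proj₁ (isCons k a))) (≡.trans (ga≗ga′ Fin.zero) (proj₁ (isCons k′ a′)))))))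
        distinct))

module PolyAlgebra {c ℓ} (K : Field c ℓ) (n : ℕ) where
  open Field K renaming (refl to ≈-refl)
  open Poly K n
  open import Algebra.Properties.CommutativeSemigroup +-commutativeSemigroup using (interchange)
  open import Algebra.Properties.CommutativeSemigroup *-commutativeSemigroup using (x∙yz≈y∙xz)
  open import Algebra.Definitions.RawMonoid +-rawMonoid using () renaming (_×_ to _×ᴷ_)
  open import Relation.Binary.Reasoning.Setoid setoid

  Σ-cong : ∀ {A : Set} (xs : List A) {f g : A → Carrier} → (∀ a → f a ≈ g a) → Σ[ xs ] f ≈ Σ[ xs ] g
  Σ-cong []       f≈g = ≈-refl
  Σ-cong (x ∷ xs) f≈g = +-cong (f≈g x) (Σ-cong xs f≈g)

  Σ-zero : ∀ {A : Set} (xs : List A) {f : A → Carrier} → (∀ a → f a ≈ 0#) → Σ[ xs ] f ≈ 0#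
  Σ-zero []       f≈0 = ≈-refl
  Σ-zero (x ∷ xs) f≈0 = trans (+-cong (f≈0 x) (Σ-zero xs f≈0)) (+-identityʳ 0#)

  Σ-+ : ∀ {A : Set} (xs : List A) (f g : A → Carrier) → Σ[ xs ] (λ a → f a + g a) ≈ Σ[ xs ] f + Σ[ xs ] g
  Σ-+ []       f g = sym (+-identityʳ 0#)
  Σ-+ (x ∷ xs) f g = trans (+-cong ≈-refl (Σ-+ xs f g)) (interchange _ _ _ _)

  Σ-*ˡ : ∀ {A : Set} (xs : List A) k (f : A → Carrier) → Σ[ xs ] (λ a → k * f a) ≈ k * Σ[ xs ] f
  Σ-*ˡ []       k f = sym (zeroʳ k)
  Σ-*ˡ (x ∷ xs) k f = trans (+-cong ≈-refl (Σ-*ˡ xs k f)) (sym (distribˡ k _ _))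

  𝟙 : ∀ {p} {P : Set p} → Dec P → Carrier
  𝟙 (yes _) = 1#
  𝟙 (no  _) = 0#

  𝟙-yes : ∀ {p} {P : Set p} (P? : Dec P) → P → 𝟙 P? ≈ 1#
  𝟙-yes (yes _) _  = ≈-refl
  𝟙-yes (no ¬p) p = ⊥-elim (¬p p)

  𝟙-no : ∀ {p} {P : Set p} (P? : Dec P) → ¬ P → 𝟙 P? ≈ 0#
  𝟙-no (yes p) ¬p = ⊥-elim (¬p p)
  𝟙-no (no _)  _  = ≈-refl

  𝟙-* : ∀ {p q} {P : Set p} {Q : Set q} (P? : Dec P) (Q? : Dec Q) → 𝟙 P? * 𝟙 Q? ≈ 𝟙 (P? ×-dec Q?)
  𝟙-* (yes _) (yes _) = *-identityˡ 1#
  𝟙-* (yes _) (no  _) = zeroʳ 1#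
  𝟙-* (no  _) _       = zeroˡ _

  Σ-𝟙 : ∀ {A : Set} {p} {P : A → Set p} (P? : ∀ a → Dec (P a)) xs →
        Σ[ xs ] (λ a → 𝟙 (P? a)) ≈ length (filter P? xs) ×ᴷ 1#
  Σ-𝟙 P? []       = ≈-refl
  Σ-𝟙 P? (x ∷ xs) with P? x
  ... | yes _ = +-cong ≈-refl (Σ-𝟙 P? xs)
  ... | no  _ = trans (+-identityˡ _) (Σ-𝟙 P? xs)

  ·ₚ-cong : ∀ {p p′ q q′} → p ≈ₚ p′ → q ≈ₚ q′ → (p ·ₚ q) ≈ₚ (p′ ·ₚ q′)
  ·ₚ-cong p≈p′ q≈q′ d = Σ-cong (below d) (λ a → *-cong (p≈p′ a) (q≈q′ _))

  ·ₚ-zeroˡ : ∀ q → ((λ _ → 0#) ·ₚ q) ≈ₚ (λ _ → 0#)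
  ·ₚ-zeroˡ q d = Σ-zero (below d) (λ a → zeroˡ _)

  ·ₚ-zeroʳ : ∀ p → (p ·ₚ (λ _ → 0#)) ≈ₚ (λ _ → 0#)
  ·ₚ-zeroʳ p d = Σ-zero (below d) (λ a → zeroʳ _)

  ·ₚ-linearˡ : ∀ k p r q → ((λ x → k * p x + r x) ·ₚ q) ≈ₚ (λ d → k * (p ·ₚ q) d + (r ·ₚ q) d)
  ·ₚ-linearˡ k p r q d = begin
    Σ[ below d ] (λ a → (k * p a + r a) * q (d ∸ᵐ a))
      ≈⟨ Σ-cong (below d) (λ a → trans (distribʳ _ _ _) (+-cong (*-assoc _ _ _) ≈-refl)) ⟩
    Σ[ below d ] (λ a → k * (p a * q (d ∸ᵐ a)) + r a * q (d ∸ᵐ a))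
      ≈⟨ Σ-+ (below d) _ _ ⟩
    Σ[ below d ] (λ a → k * (p a * q (d ∸ᵐ a))) + (r ·ₚ q) d
      ≈⟨ +-cong (Σ-*ˡ (below d) k _) ≈-refl ⟩
    k * (p ·ₚ q) d + (r ·ₚ q) d ∎

  ·ₚ-linearʳ : ∀ k p r q → (q ·ₚ (λ x → k * p x + r x)) ≈ₚ (λ d → k * (q ·ₚ p) d + (q ·ₚ r) d)
  ·ₚ-linearʳ k p r q d = begin
    Σ[ below d ] (λ a → q a * (k * p (d ∸ᵐ a) + r (d ∸ᵐ a)))
      ≈⟨ Σ-cong (below d) (λ a → trans (distribˡ _ _ _) (+-cong (x∙yz≈y∙xz _ _ _) ≈-refl)) ⟩
    Σ[ below d ] (λ a → k * (q a * p (d ∸ᵐ a)) + q a * r (d ∸ᵐ a))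
      ≈⟨ Σ-+ (below d) _ _ ⟩
    Σ[ below d ] (λ a → k * (q a * p (d ∸ᵐ a))) + (q ·ₚ r) d
      ≈⟨ +-cong (Σ-*ˡ (below d) k _) ≈-refl ⟩
    k * (q ·ₚ p) d + (q ·ₚ r) d ∎

module InvariantRing {c ℓ} (K : Field c ℓ) (n : ℕ)
                     (G : List (LocalBij n)) (isPermGroupoid : IsPermGroupoid G) where
  open Field K renaming (refl to ≈-refl) hiding (inverse)
  open Poly K n
  open PolyAlgebra K n
  open Orbits G isPermGroupoid
  open import Algebra.Properties.Group +-group using (//-rightDividesˡ; x≈y⇒x∙y⁻¹≈ε)

  orbitSum : Mono n → Pol
  orbitSum d e = 𝟙 (InOrbit? d e)

  orbitSum-isOrbitSum : ∀ d → IsOrbitSum G d (orbitSum d)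
  orbitSum-isOrbitSum d e = 𝟙-yes (InOrbit? d e) , 𝟙-no (InOrbit? d e)

  IsOrbitSum⇒≈orbitSum : ∀ {d q} → IsOrbitSum G d q → q ≈ₚ orbitSum d
  IsOrbitSum⇒≈orbitSum {d} isOrbitSum e with InOrbit? d e
  ... | yes d~e = proj₁ (isOrbitSum e) d~e
  ... | no  d≁e = proj₂ (isOrbitSum e) d≁e

  Invariant : Pol → Set ℓ
  Invariant p = ∀ {x y} → x ~ y → p x ≈ p y

  orbitSum-invariant : ∀ d → Invariant (orbitSum d)
  orbitSum-invariant d {x} {y} x~y with InOrbit? d x | InOrbit? d y
  ... | yes _   | yes _   = ≈-refl
  ... | no  _   | no  _   = ≈-refl
  ... | yes d~x | no  d≁y = ⊥-elim (d≁y (InOrbit-trans d~x x~y))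
  ... | no  d≁x | yes d~y = ⊥-elim (d≁x (InOrbit-trans d~y (InOrbit-sym x~y)))

  InInvariantRing-resp-≈ₚ : ∀ {p q} → p ≈ₚ q → InInvariantRing G q → InInvariantRing G p
  InInvariantRing-resp-≈ₚ p≈q (ts , q≈ts) = ts , λ e → trans (p≈q e) (q≈ts e)

  -- Peeling off coefficient(d) · o(x^d) leaves an invariant polynomial vanishing on the orbit of d.
  invariant⇒InInvariantRing : ∀ (ds : List (Mono n)) p → Invariant p →
    (∀ e → ¬ e ∈ᵐ ds → p e ≈ 0#) → InInvariantRing G p
  invariant⇒InInvariantRing []       p _         vanishes = [] , λ e → vanishes e (λ ())
  invariant⇒InInvariantRing (d ∷ ds) p invariant vanishes =
    term ∷ ts , λ e → trans (split e) (+-cong ≈-refl (p′≈ts e))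
    where
    term : Term G
    term = record { coeff = p d ; mono = d ; osum = orbitSum d ; isOS = orbitSum-isOrbitSum d }
    p′ : Pol
    p′ e = p e - p d * orbitSum d e
    split : ∀ e → p e ≈ p d * orbitSum d e + p′ e
    split e = sym (trans (+-comm _ _) (//-rightDividesˡ (p d * orbitSum d e) (p e)))
    p′-invariant : Invariant p′
    p′-invariant x~y = +-cong (invariant x~y) (-‿cong (*-cong ≈-refl (orbitSum-invariant d x~y)))
    p′-vanishes : ∀ e → ¬ e ∈ᵐ ds → p′ e ≈ 0#
    p′-vanishes e e∉ds = x≈y⇒x∙y⁻¹≈ε (agrees (InOrbit? d e))
      where
      agrees : (d~e? : Dec (d ~ e)) → p e ≈ p d * 𝟙 d~e?
      agrees (yes d~e) = trans (sym (invariant d~e)) (sym (*-identityʳ _))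
      agrees (no  d≁e) = trans (vanishes e λ
        { (here e≗d)  → d≁e (InOrbit-resp-≗ (λ _ → refl) (λ i → ≡.sym (e≗d i)) (InOrbit-refl d))
        ; (there e∈ds) → e∉ds e∈ds }) (sym (zeroʳ _))
    ts : List (Term G)
    ts = proj₁ (invariant⇒InInvariantRing ds p′ p′-invariant p′-vanishes)
    p′≈ts : p′ ≈ₚ evalTerms ts
    p′≈ts = proj₂ (invariant⇒InInvariantRing ds p′ p′-invariant p′-vanishes)

  evalTerms-++ : ∀ (ts us : List (Term G)) e → evalTerms (ts ++ us) e ≈ evalTerms ts e + evalTerms us e
  evalTerms-++ []       us e = sym (+-identityˡ _)
  evalTerms-++ (t ∷ ts) us e = trans (+-cong ≈-refl (evalTerms-++ ts us e)) (sym (+-assoc _ _ _))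

  scaleTerm : Carrier → Term G → Term G
  scaleTerm k t = record t { coeff = k * Term.coeff t }

  evalTerms-scale : ∀ k (ts : List (Term G)) e → evalTerms (List.map (scaleTerm k) ts) e ≈ k * evalTerms ts e
  evalTerms-scale k []       e = sym (zeroʳ k)
  evalTerms-scale k (t ∷ ts) e =
    trans (+-cong (*-assoc _ _ _) (evalTerms-scale k ts e)) (sym (distribˡ k _ _))

  InInvariantRing-linear : ∀ k {p q} → InInvariantRing G p → InInvariantRing G q →
                           InInvariantRing G (λ e → k * p e + q e)
  InInvariantRing-linear k (ts , p≈ts) (us , q≈us) = List.map (scaleTerm k) ts ++ us , λ e →
    trans (+-cong (*-cong ≈-refl (p≈ts e)) (q≈us e))
          (sym (trans (evalTerms-++ (List.map (scaleTerm k) ts) us e)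
                      (+-cong (evalTerms-scale k ts e) ≈-refl)))

  InInvariantRing-·ₚ-fromOrbitSums : (∀ a b → InInvariantRing G (orbitSum a ·ₚ orbitSum b)) →
    ∀ p q → InInvariantRing G p → InInvariantRing G q → InInvariantRing G (p ·ₚ q)
  InInvariantRing-·ₚ-fromOrbitSums orbitSum·orbitSum p q (ts , p≈ts) (us , q≈us) =
    InInvariantRing-resp-≈ₚ (·ₚ-cong {p} {evalTerms ts} {q} {evalTerms us} p≈ts q≈us) (left ts)
    where
    osum≈ : ∀ (t : Term G) → Term.osum t ≈ₚ orbitSum (Term.mono t)
    osum≈ t = IsOrbitSum⇒≈orbitSum (Term.isOS t)
    right : ∀ (t : Term G) us → InInvariantRing G (Term.osum t ·ₚ evalTerms us)
    right t []       = InInvariantRing-resp-≈ₚ (·ₚ-zeroʳ (Term.osum t)) ([] , λ _ → ≈-refl)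
    right t (u ∷ us) = InInvariantRing-resp-≈ₚ (·ₚ-linearʳ (Term.coeff u) (Term.osum u) (evalTerms us) (Term.osum t))
      (InInvariantRing-linear (Term.coeff u)
        (InInvariantRing-resp-≈ₚ (·ₚ-cong (osum≈ t) (osum≈ u)) (orbitSum·orbitSum _ _)) (right t us))
    left : ∀ ts → InInvariantRing G (evalTerms ts ·ₚ evalTerms us)
    left []       = InInvariantRing-resp-≈ₚ (·ₚ-zeroˡ (evalTerms us)) ([] , λ _ → ≈-refl)
    left (t ∷ ts) = InInvariantRing-resp-≈ₚ (·ₚ-linearˡ (Term.coeff t) (Term.osum t) (evalTerms ts) (evalTerms us))
      (InInvariantRing-linear (Term.coeff t) (right t us) (left ts))

module OrbitSumProduct {c ℓ} (K : Field c ℓ) (n : ℕ)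
                       (G : List (LocalBij n)) (isPermGroupoid : IsPermGroupoid G) (a b : Mono n) where
  open Field K renaming (refl to ≈-refl) hiding (inverse)
  open Poly K n
  open PolyAlgebra K n
  open Divisors K n
  open Orbits G isPermGroupoid
  open InvariantRing K n G isPermGroupoid
  open import Algebra.Definitions.RawMonoid +-rawMonoid using () renaming (_×_ to _×ᴷ_)
  open import Data.List.Membership.Setoid.Properties using () renaming (∈-filter⁺ to ∈ᵐ-filter⁺)

  Splitting : Mono n → Mono n → Set
  Splitting x c = a ~ c × b ~ (x ∸ᵐ c)

  Splitting? : ∀ x c → Dec (Splitting x c)
  Splitting? x c = InOrbit? a c ×-dec InOrbit? b (x ∸ᵐ c)

  Splitting-resp-≗ : ∀ x {c c′} → c ≗ c′ → Splitting x c → Splitting x c′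
  Splitting-resp-≗ x c≗c′ (a~c , b~x∸c) =
    InOrbit-resp-≗ (λ _ → refl) c≗c′ a~c ,
    InOrbit-resp-≗ (λ _ → refl) (λ i → cong (x i ∸_) (c≗c′ i)) b~x∸c

  splittings : Mono n → List (Mono n)
  splittings x = filter (Splitting? x) (below x)

  orbitSum·orbitSum≈#splittings : ∀ x → (orbitSum a ·ₚ orbitSum b) x ≈ length (splittings x) ×ᴷ 1#
  orbitSum·orbitSum≈#splittings x =
    trans (Σ-cong (below x) (λ c → 𝟙-* (InOrbit? a c) (InOrbit? b (x ∸ᵐ c))))
          (Σ-𝟙 (Splitting? x) (below x))

  #splittings-mono : ∀ {x y} → x ~ y → length (splittings x) ≤ length (splittings y)
  #splittings-mono {x} {y} (f , f∈G , act) = length-≤-injection (Monoₛ n) transport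
    (AllPairsₚ.filter⁺ (Splitting? x) (below-unique x)) transport-∈
    (λ c∈ c′∈ → transport-injective (divisor c∈) (divisor c′∈))
    where
    open Transport f act
    divisor : ∀ {c} → c ∈ splittings x → c ≤ᵐ x
    divisor c∈ = All.lookup (below-sound x) (proj₁ (∈-filter⁻ (Splitting? x) {xs = below x} c∈))
    transport-∈ : ∀ {c} → c ∈ splittings x → transport c ∈ᵐ splittings y
    transport-∈ {c} c∈ with ∈-filter⁻ (Splitting? x) {xs = below x} c∈
    ... | _ , (a~c , b~x∸c) =
      ∈ᵐ-filter⁺ (Monoₛ n) (Splitting? y) (Splitting-resp-≗ y)
        (below-complete y (transport c) (transport-≤ᵐ (divisor c∈)))
        (InOrbit-trans a~c (f , f∈G , transport-acts (divisor c∈)) ,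
         InOrbit-trans b~x∸c (f , f∈G , transport-acts-∸ᵐ c))

  #splittings-invariant : ∀ {x y} → x ~ y → length (splittings x) ≡ length (splittings y)
  #splittings-invariant x~y = ℕₚ.≤-antisym (#splittings-mono x~y) (#splittings-mono (InOrbit-sym x~y))

  bound : Mono n
  bound _ = degree a ℕ.+ degree b

  splittings-outside-bound : ∀ x → ¬ x ∈ᵐ below bound → splittings x ≡ []
  splittings-outside-bound x x∉ = Listₚ.filter-none (Splitting? x)
    (All.map (λ {c} c≤x split → x∉ (below-complete bound x (x≤bound c≤x split))) (below-sound x))
    where
    x≤bound : ∀ {c} → c ≤ᵐ x → Splitting x c → x ≤ᵐ bound
    x≤bound c≤x (a~c , b~x∸c) i = subst (_≤ bound i) (ℕₚ.m+[n∸m]≡n (c≤x i))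
      (ℕₚ.+-mono-≤ (InOrbit⇒≤degree a~c i) (InOrbit⇒≤degree b~x∸c i))

  orbitSum·orbitSum∈InvariantRing : InInvariantRing G (orbitSum a ·ₚ orbitSum b)
  orbitSum·orbitSum∈InvariantRing =
    invariant⇒InInvariantRing (below bound) (orbitSum a ·ₚ orbitSum b) invariant vanishes
    where
    invariant : Invariant (orbitSum a ·ₚ orbitSum b)
    invariant {x} {y} x~y = trans (orbitSum·orbitSum≈#splittings x)
      (trans (reflexive (cong (_×ᴷ 1#) (#splittings-invariant x~y))) (sym (orbitSum·orbitSum≈#splittings y)))
    vanishes : ∀ x → ¬ x ∈ᵐ below bound → (orbitSum a ·ₚ orbitSum b) x ≈ 0#
    vanishes x x∉ = trans (orbitSum·orbitSum≈#splittings x)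
      (reflexive (cong (λ cs → length cs ×ᴷ 1#) (splittings-outside-bound x x∉)))

corollary6 : ∀ {c ℓ} (K : Field c ℓ) (n : ℕ) (G : List (LocalBij n)) → IsPermGroupoid G →
    ∀ (p q : Poly.Pol K n) → Poly.InInvariantRing K n G p → Poly.InInvariantRing K n G q →
    Poly.InInvariantRing K n G (Poly._·ₚ_ K n p q)
corollary6 K n G isPermGroupoid =
  InInvariantRing-·ₚ-fromOrbitSums (OrbitSumProduct.orbitSum·orbitSum∈InvariantRing K n G isPermGroupoid)
  where open InvariantRing K n G isPermGroupoid
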